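{- Let $\Sigma$ be a finite alphabet with $|\Sigma|=\sigma$. There is a constant $C$ (depending only on $\sigma$) such that for all $n\ge1$, $|B_1(n)|\le C\,n^4\sigma^{n/2}$, where $B_1(n)$ is the set of patterns $p\in\Sigma^n$ for which there exists a nonempty string $b\neq p$ that is both a prefix and a suffix of $p$ such that the string $p(b)$ has a substring $p'=p(b)[i+1..i+n]$ with $0<i<|p(b)|-n$ (i.e. an occurrence of length $n$ that is neither the prefix nor the suffix of $p(b)$) which differs from $p$ in at most two positions.
   Context: Strings are indexed from 1. For $p$ and a nonempty string $b\ne p$ that is both a prefix and a suffix of $p$, $p(b)$ denotes the string $ubv$ where $u,v$ are such that $ub=bv=p$ (so $|p(b)|=2n-|b|$). Two strings of equal length differ in at most $t$ positions if their Hamming distance is at most $t$. -}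

module Defs where

open import Data.Nat using (ℕ; zero; suc; _+_; _∸_; _<_; _≤_)
open import Data.Fin using (Fin; _≟_)
open import Data.List using (List; []; _∷_; _++_; length; take; drop)
open import Data.Product using (Σ; ∃-syntax; _×_)
open import Relation.Binary.PropositionalEquality using (_≡_; _≢_)
open import Relation.Nullary using (yes; no)

-- Strings over the alphabet Σ = Fin σ are lists (positions indexed from 0 here;
-- the paper indexes from 1, so p(b)[i+1..i+n] = take n (drop i p(b))).
Str : ℕ → Set
Str σ = List (Fin σ)

-- Hamming distance: number of positions (among the common prefix range)
-- where the two strings differ.  Only applied to strings of equal length.
ham : ∀ {σ} → Str σ → Str σ → ℕ
ham []       _        = 0
ham (_ ∷ _)  []       = 0
ham (x ∷ xs) (y ∷ ys) with x ≟ y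
... | yes _ = ham xs ys
... | no  _ = suc (ham xs ys)

-- p ∈ B₁(|p|): there is a nonempty b ≠ p that is a prefix (b ++ v ≡ p) and a
-- suffix (u ++ b ≡ p) of p, such that p(b) = u b v = u ++ p has a length-|p|
-- substring starting at offset i with 0 < i < |p(b)| - |p| that is within
-- Hamming distance 2 of p.
InB1 : ∀ {σ} → Str σ → Set
InB1 {σ} p =
  ∃[ b ] ∃[ u ] ∃[ v ]
    (b ≢ [] × b ≢ p × u ++ b ≡ p × b ++ v ≡ p ×
     ∃[ i ] (0 < i × i < length (u ++ p) ∸ length p ×
             ham (take (length p) (drop i (u ++ p))) p ≤ 2))

-- If p ∈ B₁(n) has border b = p[q+1..n] and its approximate occurrence starts at
-- offset i of p(b) = p[1..q] p, then 0 < i < q, p(b) agrees with p on its first n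
-- letters and with p shifted by q after its first q, and p[j] = p(b)[i + j] outside
-- the at most two mismatch positions M.  Hence each letter of p equals a letter at a
-- smaller position: p[j] = p[j - i] for j ≥ i, and p[j] = p[i + j - q] for j < i
-- once i + j ≥ n, i.e. beyond the first half of p; the exceptions lie in M or i + M.
-- So p is determined by i, q, M, its first ⌊n/2⌋ letters and four more letters,
-- whence |B₁(n)| ≤ n (n + 1) n² σ^⌊n/2⌋ (σ + 1)⁴ and |B₁(n)|² ≤ 4 (σ + 1)⁸ n⁸ σⁿ.
module Submission where

open import Data.Fin using (Fin)
import Data.Fin as Fin
open import Data.List
  using (List; []; _∷_; [_]; _++_; length; take; drop; map; replicate; upTo; allFin;
         cartesianProduct; cartesianProductWith)
open import Data.List.Properties
  using (length-++; length-++-sucʳ; length-map; length-drop; length-take; length-replicate;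
         length-upTo; length-tabulate; ++-assoc; ∷-injectiveˡ; ∷-injectiveʳ)
open import Data.List.Membership.Propositional using (_∈_; _∉_)
open import Data.List.Membership.Propositional.Properties
  using (∈-++⁺ˡ; ∈-++⁺ʳ; ∈-++⁻; ∈-map⁺; ∈-∃++; ∈-upTo⁺; ∈-allFin;
         ∈-cartesianProduct⁺; ∈-cartesianProductWith⁺)
open import Data.List.Relation.Unary.All using (All; []; _∷_)
import Data.List.Relation.Unary.All as All
import Data.List.Relation.Unary.All.Properties as All
open import Data.List.Relation.Unary.Any using (here; there)
open import Data.List.Relation.Unary.AllPairs using (_∷_)
open import Data.List.Relation.Unary.Unique.Propositional using (Unique)
open import Data.Maybe using (Maybe; just; nothing)
open import Data.Nat
  using (ℕ; zero; suc; _+_; _*_; _^_; _∸_; _≤_; _<_; z≤n; s≤s; _≟_; _<?_; ⌊_/2⌋; NonZero)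
open import Data.List.Membership.DecPropositional _≟_ using (_∈?_)
open import Data.Nat.Properties
open import Data.Nat.Induction using (<-rec)
open import Data.Nat.Tactic.RingSolver using (solve-∀)
open import Data.Product using (∃-syntax; _×_; _,_; proj₁; proj₂)
open import Data.Product.Properties using (,-injectiveˡ; ,-injectiveʳ)
open import Data.Sum using (_⊎_; inj₁; inj₂)
open import Function using (_∘_)
open import Relation.Binary.PropositionalEquality
  using (_≡_; _≢_; refl; sym; trans; cong; cong₂; subst; module ≡-Reasoning)
open import Relation.Nullary using (yes; no; contradiction)
open import Defs

module _ {A : Set} where

  infixl 10 _!?_

  _!?_ : List A → ℕ → Maybe A
  []       !? _     = nothing
  (x ∷ xs) !? zero  = just x
  (x ∷ xs) !? suc j = xs !? j

  !?-++ˡ : ∀ xs {ys j} → j < length xs → (xs ++ ys) !? j ≡ xs !? j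
  !?-++ˡ (x ∷ xs) {j = zero}  _         = refl
  !?-++ˡ (x ∷ xs) {j = suc j} (s≤s j<n) = !?-++ˡ xs j<n

  !?-++ʳ : ∀ xs {ys} j → (xs ++ ys) !? (length xs + j) ≡ ys !? j
  !?-++ʳ []       j = refl
  !?-++ʳ (x ∷ xs) j = !?-++ʳ xs j

  !?-take : ∀ xs {k j} → j < k → take k xs !? j ≡ xs !? j
  !?-take []       {suc k}          _         = refl
  !?-take (x ∷ xs) {suc k} {zero}  _         = refl
  !?-take (x ∷ xs) {suc k} {suc j} (s≤s j<k) = !?-take xs j<k

  !?-drop : ∀ xs i j → drop i xs !? j ≡ xs !? (i + j)
  !?-drop xs       zero    j = refl
  !?-drop []       (suc i) j = refl
  !?-drop (x ∷ xs) (suc i) j = !?-drop xs i j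

  !?-extensionality : ∀ {xs ys} → length xs ≡ length ys →
                      (∀ j → j < length xs → xs !? j ≡ ys !? j) → xs ≡ ys
  !?-extensionality {[]}     {[]}     _    _  = refl
  !?-extensionality {x ∷ xs} {y ∷ ys} ∣x∣≡∣y∣ eq with refl ← eq 0 (s≤s z≤n) =
    cong (x ∷_) (!?-extensionality (suc-injective ∣x∣≡∣y∣) (λ j j<n → eq (suc j) (s≤s j<n)))

  length-take-≤ : ∀ (xs : List A) {k} → k ≤ length xs → length (take k xs) ≡ k
  length-take-≤ xs {k} k≤n = trans (length-take k xs) (m≤n⇒m⊓n≡m k≤n)

  border-extension : ∀ (u b v : List A) {p} → u ++ b ≡ p → b ++ v ≡ p → u ++ p ≡ p ++ v
  border-extension u b v {p} ub≡p bv≡p = begin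
    u ++ p         ≡⟨ cong (u ++_) bv≡p ⟨
    u ++ (b ++ v)  ≡⟨ ++-assoc u b v ⟨
    (u ++ b) ++ v  ≡⟨ cong (_++ v) ub≡p ⟩
    p ++ v         ∎
    where open ≡-Reasoning

  map-≡⇒≡-on : ∀ {B : Set} {f g : B → A} {xs} → map f xs ≡ map g xs → ∀ {x} → x ∈ xs → f x ≡ g x
  map-≡⇒≡-on {xs = _ ∷ _} eq (here refl) = ∷-injectiveˡ eq
  map-≡⇒≡-on {xs = _ ∷ _} eq (there x∈) = map-≡⇒≡-on (∷-injectiveʳ eq) x∈

  ∈-++-∷-skip : ∀ {x y : A} ys zs → y ∈ ys ++ x ∷ zs → y ≢ x → y ∈ ys ++ zs
  ∈-++-∷-skip ys zs y∈ y≢x with ∈-++⁻ ys y∈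
  ... | inj₁ y∈ys         = ∈-++⁺ˡ y∈ys
  ... | inj₂ (here y≡x)   = contradiction y≡x y≢x
  ... | inj₂ (there y∈zs) = ∈-++⁺ʳ ys y∈zs

module _ {A B : Set} where

  length-cartesianProductWith : ∀ {C : Set} (f : A → B → C) xs ys →
    length (cartesianProductWith f xs ys) ≡ length xs * length ys
  length-cartesianProductWith f []       ys = refl
  length-cartesianProductWith f (x ∷ xs) ys = begin
    length (map (f x) ys ++ cartesianProductWith f xs ys)     ≡⟨ length-++ (map (f x) ys) ⟩
    length (map (f x) ys) + length (cartesianProductWith f xs ys)
      ≡⟨ cong₂ _+_ (length-map (f x) ys) (length-cartesianProductWith f xs ys) ⟩
    length ys + length xs * length ys                          ∎
    where open ≡-Reasoning

  module _ {P : A → Set} (f : ∀ {x} → P x → B)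
           (f-injective : ∀ {x y} (px : P x) (py : P y) → f px ≡ f py → x ≡ y) where

    length-≤-by-injection : ∀ {xs ys} → Unique xs → All P xs →
                            (∀ {x} → x ∈ xs → (px : P x) → f px ∈ ys) → length xs ≤ length ys
    length-≤-by-injection {[]}     _              _          _    = z≤n
    length-≤-by-injection {x ∷ xs} (x∉xs ∷ xs!) (px ∷ pxs) into
      with ys , zs , refl ← ∈-∃++ (into (here refl) px) =
      subst (suc (length xs) ≤_) (sym (length-++-sucʳ ys (f px) zs))
        (s≤s (length-≤-by-injection xs! pxs into′))
      where
      into′ : ∀ {y} → y ∈ xs → (py : P y) → f py ∈ ys ++ zs
      into′ y∈xs py = ∈-++-∷-skip ys zs (into (there y∈xs) py)
        (λ e → All.lookup x∉xs y∈xs (sym (f-injective py px e)))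

listsOfLength : ∀ {A : Set} → ℕ → List A → List (List A)
listsOfLength zero    E = [ [] ]
listsOfLength (suc k) E = cartesianProductWith _∷_ E (listsOfLength k E)

length-listsOfLength : ∀ {A : Set} k (E : List A) {e} → length E ≡ e →
                       length (listsOfLength k E) ≡ e ^ k
length-listsOfLength zero    _ _    = refl
length-listsOfLength (suc k) E refl =
  trans (length-cartesianProductWith _∷_ E (listsOfLength k E))
        (cong (length E *_) (length-listsOfLength k E refl))

∈-listsOfLength : ∀ {A : Set} {E : List A} {xs k} → All (_∈ E) xs → length xs ≡ k →
                  xs ∈ listsOfLength k E
∈-listsOfLength []          refl = here refl
∈-listsOfLength (x∈ ∷ xs∈) refl = ∈-cartesianProductWith⁺ _∷_ x∈ (∈-listsOfLength xs∈ refl)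

≡-by-descent : ∀ {B : Set} (f g : ℕ → B) n →
  (∀ j → j < n → f j ≡ g j ⊎ ∃[ k ] (k < j × f j ≡ f k × g j ≡ g k)) →
  ∀ j → j < n → f j ≡ g j
≡-by-descent f g n step = <-rec (λ j → j < n → f j ≡ g j) agree
  where
  agree : ∀ j → (∀ {k} → k < j → k < n → f k ≡ g k) → j < n → f j ≡ g j
  agree j ih j<n with step j j<n
  ... | inj₁ fj≡gj                         = fj≡gj
  ... | inj₂ (k , k<j , fj≡fk , gj≡gk) =
    trans fj≡fk (trans (ih k<j (<-trans k<j j<n)) (sym gj≡gk))

⌊n/2⌋+⌊n/2⌋≤n : ∀ n → ⌊ n /2⌋ + ⌊ n /2⌋ ≤ n
⌊n/2⌋+⌊n/2⌋≤n n =
  ≤-trans (+-monoʳ-≤ ⌊ n /2⌋ (⌊n/2⌋≤⌈n/2⌉ n)) (≤-reflexive (⌊n/2⌋+⌈n/2⌉≡n n))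

n≤1+⌊n/2⌋+⌊n/2⌋ : ∀ n → n ≤ suc (⌊ n /2⌋ + ⌊ n /2⌋)
n≤1+⌊n/2⌋+⌊n/2⌋ zero          = z≤n
n≤1+⌊n/2⌋+⌊n/2⌋ (suc zero)    = ≤-refl
n≤1+⌊n/2⌋+⌊n/2⌋ (suc (suc n)) rewrite +-suc ⌊ n /2⌋ ⌊ n /2⌋ =
  s≤s (s≤s (n≤1+⌊n/2⌋+⌊n/2⌋ n))

module _ {A : Set} where

  -- W lists the letters of p(b) = u p, where q = |u|; the occurrence of p at
  -- offset i of p(b) mismatches only at positions in M (padded to two entries).
  record ShiftedSelfMatch (p : List A) (i q : ℕ) (M : List ℕ) : Set where
    field
      0<i       : 0 < i
      i<q       : i < q
      q≤∣p∣     : q ≤ length p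
      M-length  : length M ≡ 2
      M-bounded : All (_< length p) M
      W         : ℕ → Maybe A
      W-prefix  : ∀ k → k < length p → W k ≡ p !? k
      W-shift   : ∀ k → W (q + k) ≡ p !? k
      W-match   : ∀ j → j < length p → j ∉ M → W (i + j) ≡ p !? j

    match-back : ∀ {j k} → q + k ≡ i + j → j < length p → j ∉ M → p !? j ≡ p !? k
    match-back {j} {k} q+k≡i+j j<n j∉M = begin
      p !? j    ≡⟨ W-match j j<n j∉M ⟨
      W (i + j) ≡⟨ cong W q+k≡i+j ⟨
      W (q + k) ≡⟨ W-shift k ⟩
      p !? k    ∎
      where open ≡-Reasoning

    match-forward : ∀ {k} → i + k < length p → k ∉ M → p !? (i + k) ≡ p !? k
    match-forward {k} i+k<n k∉M =
      trans (sym (W-prefix (i + k) i+k<n)) (W-match k (≤-<-trans (m≤n+m k i) i+k<n) k∉M)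

  Witness : List A → Set
  Witness p = ∃[ i ] ∃[ q ] ∃[ M ] ShiftedSelfMatch p i q M

  module _ {p p′ : List A} {i q M} (R : ShiftedSelfMatch p i q M) (R′ : ShiftedSelfMatch p′ i q M)
           (∣p′∣≡∣p∣ : length p′ ≡ length p) where
    open ShiftedSelfMatch

    private
      n = length p
      h = ⌊ n /2⌋

    agree-or-descend :
      (∀ j → j < h → p !? j ≡ p′ !? j) →
      (∀ m → m ∈ M → p !? m ≡ p′ !? m) →
      (∀ m → m ∈ M → p !? (i + m) ≡ p′ !? (i + m)) →
      ∀ j → j < n → p !? j ≡ p′ !? j ⊎ ∃[ k ] (k < j × p !? j ≡ p !? k × p′ !? j ≡ p′ !? k)
    agree-or-descend on-prefix on-M on-i+M j j<n with j <? i
    agree-or-descend on-prefix on-M on-i+M j j<n | no j≮i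
      with k , refl ← m≤n⇒∃[o]m+o≡n (≮⇒≥ j≮i) with k ∈? M
    ... | yes k∈M = inj₁ (on-i+M k k∈M)
    ... | no  k∉M = inj₂ (k , m<n+m k (0<i R) , match-forward R j<n k∉M
                         , match-forward R′ (subst (j <_) (sym ∣p′∣≡∣p∣) j<n) k∉M)
    agree-or-descend on-prefix on-M on-i+M j j<n | yes j<i with j ∈? M | j <? h
    ... | yes j∈M | _       = inj₁ (on-M j j∈M)
    ... | no  _   | yes j<h = inj₁ (on-prefix j j<h)
    ... | no  j∉M | no  j≮h =
      inj₂ (k , k<j , match-back R q+k≡i+j j<n j∉M
           , match-back R′ q+k≡i+j (subst (j <_) (sym ∣p′∣≡∣p∣) j<n) j∉M)
      where
      h≤j = ≮⇒≥ j≮h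
      q≤i+j : q ≤ i + j
      q≤i+j = ≤-trans (q≤∣p∣ R)
        (≤-trans (n≤1+⌊n/2⌋+⌊n/2⌋ n) (+-mono-≤ (≤-<-trans h≤j j<i) h≤j))
      k = i + j ∸ q
      q+k≡i+j : q + k ≡ i + j
      q+k≡i+j = m+[n∸m]≡n q≤i+j
      k<j : k < j
      k<j = +-cancelˡ-< q k j
        (subst (_< q + j) (sym q+k≡i+j) (+-monoˡ-< j (i<q R)))

  Code : Set
  Code = ℕ × ℕ × List ℕ × List A × List (Maybe A)

  encode : (p : List A) → Witness p → Code
  encode p (i , q , M , _) = i , q , M , take ⌊ length p /2⌋ p , map (p !?_) (M ++ map (i +_) M)

  encode-injective : ∀ {p p′} (w : Witness p) (w′ : Witness p′) → length p ≡ length p′ →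
                     encode p w ≡ encode p′ w′ → p ≡ p′
  encode-injective {p} {p′} (i , q , M , R) (i′ , q′ , M′ , R′) ∣p∣≡∣p′∣ eq
    with refl ← ,-injectiveˡ eq
       | refl ← ,-injectiveˡ (,-injectiveʳ eq)
       | refl ← ,-injectiveˡ (,-injectiveʳ (,-injectiveʳ eq)) =
    !?-extensionality ∣p∣≡∣p′∣
      (≡-by-descent (p !?_) (p′ !?_) (length p)
        (agree-or-descend R R′ (sym ∣p∣≡∣p′∣) on-prefix on-M on-i+M))
    where
    prefixes = ,-injectiveˡ (,-injectiveʳ (,-injectiveʳ (,-injectiveʳ eq)))
    letters  = ,-injectiveʳ (,-injectiveʳ (,-injectiveʳ (,-injectiveʳ eq)))
    h = ⌊ length p /2⌋
    on-prefix : ∀ j → j < h → p !? j ≡ p′ !? j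
    on-prefix j j<h = begin
      p !? j                         ≡⟨ !?-take p j<h ⟨
      take h p !? j                  ≡⟨ cong (_!? j) prefixes ⟩
      take ⌊ length p′ /2⌋ p′ !? j   ≡⟨ !?-take p′ (subst (λ m → j < ⌊ m /2⌋) ∣p∣≡∣p′∣ j<h) ⟩
      p′ !? j                        ∎
      where open ≡-Reasoning
    on-M : ∀ m → m ∈ M → p !? m ≡ p′ !? m
    on-M m m∈M = map-≡⇒≡-on letters (∈-++⁺ˡ m∈M)
    on-i+M : ∀ m → m ∈ M → p !? (i + m) ≡ p′ !? (i + m)
    on-i+M m m∈M = map-≡⇒≡-on letters (∈-++⁺ʳ M (∈-map⁺ (i +_) m∈M))

module _ {σ : ℕ} where

  mismatches : Str σ → Str σ → List ℕ
  mismatches []       _        = []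
  mismatches (_ ∷ _)  []       = []
  mismatches (x ∷ xs) (y ∷ ys) with x Fin.≟ y
  ... | yes _ = map suc (mismatches xs ys)
  ... | no  _ = 0 ∷ map suc (mismatches xs ys)

  length-mismatches : ∀ xs ys → length (mismatches xs ys) ≡ ham xs ys
  length-mismatches []       _        = refl
  length-mismatches (_ ∷ _)  []       = refl
  length-mismatches (x ∷ xs) (y ∷ ys) with x Fin.≟ y
  ... | yes _ = trans (length-map suc (mismatches xs ys)) (length-mismatches xs ys)
  ... | no  _ = cong suc (trans (length-map suc (mismatches xs ys)) (length-mismatches xs ys))

  mismatches-< : ∀ xs ys → All (_< length xs) (mismatches xs ys)
  mismatches-< []       _        = []
  mismatches-< (_ ∷ _)  []       = []
  mismatches-< (x ∷ xs) (y ∷ ys) with x Fin.≟ y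
  ... | yes _ = All.map⁺ (All.map s≤s (mismatches-< xs ys))
  ... | no  _ = s≤s z≤n ∷ All.map⁺ (All.map s≤s (mismatches-< xs ys))

  ∉-mismatches : ∀ xs ys {j} → j ∉ mismatches xs ys → j < length xs → j < length ys →
                 xs !? j ≡ ys !? j
  ∉-mismatches (x ∷ xs) (y ∷ ys) {j} j∉ _ _ with x Fin.≟ y
  ∉-mismatches (x ∷ xs) (y ∷ ys) {zero}  j∉ _         _         | yes refl = refl
  ∉-mismatches (x ∷ xs) (y ∷ ys) {suc j} j∉ (s≤s j<m) (s≤s j<n) | yes _    =
    ∉-mismatches xs ys (j∉ ∘ ∈-map⁺ suc) j<m j<n
  ∉-mismatches (x ∷ xs) (y ∷ ys) {zero}  j∉ _         _         | no  _    =
    contradiction (here refl) j∉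
  ∉-mismatches (x ∷ xs) (y ∷ ys) {suc j} j∉ (s≤s j<m) (s≤s j<n) | no  _    =
    ∉-mismatches xs ys (j∉ ∘ there ∘ ∈-map⁺ suc) j<m j<n

  mismatch-positions : ∀ {t} (xs ys : Str σ) → 0 < length ys → length xs ≡ length ys →
    ham xs ys ≤ t →
    ∃[ M ] (length M ≡ t × All (_< length ys) M ×
            (∀ j → j < length ys → j ∉ M → xs !? j ≡ ys !? j))
  mismatch-positions {t} xs ys 0<n ∣xs∣≡∣ys∣ ham≤t = D ++ replicate (t ∸ length D) 0
    , trans (length-++ D) (trans (cong (length D +_) (length-replicate (t ∸ length D)))
        (m+[n∸m]≡n (subst (_≤ t) (sym (length-mismatches xs ys)) ham≤t)))
    , All.++⁺ (subst (λ m → All (_< m) D) ∣xs∣≡∣ys∣ (mismatches-< xs ys))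
              (All.replicate⁺ (t ∸ length D) 0<n)
    , λ j j<n j∉M → ∉-mismatches xs ys (j∉M ∘ ∈-++⁺ˡ) (subst (j <_) (sym ∣xs∣≡∣ys∣) j<n) j<n
    where
    D = mismatches xs ys

  witness : {p : Str σ} → InB1 p → Witness p
  witness {p} (b , u , v , _ , _ , ub≡p , bv≡p , i , 0<i , i<∣up∣∸∣p∣ , close) =
    let M , ∣M∣≡2 , M<n , match = mismatch-positions occ p 0<n ∣occ∣≡n close in
    i , q , M , record
      { 0<i = 0<i ; i<q = i<q ; q≤∣p∣ = q≤n ; M-length = ∣M∣≡2 ; M-bounded = M<n
      ; W = (u ++ p) !?_
      ; W-prefix = λ k k<n → trans (cong (_!? k) (border-extension u b v ub≡p bv≡p)) (!?-++ˡ p k<n)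
      ; W-shift = !?-++ʳ u
      ; W-match = λ j j<n j∉M →
          trans (sym (trans (!?-take (drop i (u ++ p)) j<n) (!?-drop (u ++ p) i j)))
                (match j j<n j∉M)
      }
    where
    n = length p
    q = length u
    occ = take n (drop i (u ++ p))
    ∣up∣≡q+n : length (u ++ p) ≡ q + n
    ∣up∣≡q+n = length-++ u
    q≤n : q ≤ n
    q≤n = subst (q ≤_) (trans (sym (length-++ u)) (cong length ub≡p)) (m≤m+n q (length b))
    i<q : i < q
    i<q = subst (i <_) (trans (cong (_∸ n) ∣up∣≡q+n) (m+n∸n≡m q n)) i<∣up∣∸∣p∣
    0<n : 0 < n
    0<n = <-≤-trans 0<i (≤-trans (<⇒≤ i<q) q≤n)
    n≤∣drop∣ : n ≤ length (drop i (u ++ p))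
    n≤∣drop∣ = begin
      n                        ≤⟨ m≤n+m n (q ∸ i) ⟩
      (q ∸ i) + n              ≡⟨ +-∸-comm n (<⇒≤ i<q) ⟨
      (q + n) ∸ i              ≡⟨ cong (_∸ i) ∣up∣≡q+n ⟨
      length (u ++ p) ∸ i      ≡⟨ length-drop i (u ++ p) ⟨
      length (drop i (u ++ p)) ∎
      where open ≤-Reasoning
    ∣occ∣≡n : length occ ≡ n
    ∣occ∣≡n = length-take-≤ (drop i (u ++ p)) n≤∣drop∣

  letters : List (Maybe (Fin σ))
  letters = nothing ∷ map just (allFin σ)

  sizedCodes : ∀ n → ∃[ cs ] (length cs ≡ n * (suc n * (n ^ 2 * (σ ^ ⌊ n /2⌋ * suc σ ^ 4))))
  sizedCodes n =
    (upTo n , length-upTo n) ⊗ (upTo (suc n) , length-upTo (suc n))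
      ⊗ (listsOfLength 2 (upTo n) , length-listsOfLength 2 (upTo n) (length-upTo n))
      ⊗ (listsOfLength ⌊ n /2⌋ (allFin σ) , length-listsOfLength ⌊ n /2⌋ (allFin σ) length-allFin)
      ⊗ (listsOfLength 4 letters , length-listsOfLength 4 letters length-letters)
    where
    infixr 5 _⊗_
    _⊗_ : ∀ {X Y : Set} {a b} → ∃[ xs ] (length {A = X} xs ≡ a) → ∃[ ys ] (length {A = Y} ys ≡ b) →
          ∃[ zs ] (length zs ≡ a * b)
    (xs , ∣xs∣) ⊗ (ys , ∣ys∣) =
      cartesianProduct xs ys , trans (length-cartesianProductWith _,_ xs ys) (cong₂ _*_ ∣xs∣ ∣ys∣)
    length-allFin : length (allFin σ) ≡ σ
    length-allFin = length-tabulate (λ x → x)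
    length-letters : length letters ≡ suc σ
    length-letters = cong suc (trans (length-map just (allFin σ)) length-allFin)

  encode-∈-sizedCodes : ∀ {p} (w : Witness p) → encode p w ∈ proj₁ (sizedCodes (length p))
  encode-∈-sizedCodes {p} (i , q , M , R) =
    ∈-cartesianProduct⁺ (∈-upTo⁺ (<-≤-trans i<q q≤∣p∣))
      (∈-cartesianProduct⁺ (∈-upTo⁺ (s≤s q≤∣p∣))
        (∈-cartesianProduct⁺ (∈-listsOfLength (All.map ∈-upTo⁺ M-bounded) M-length)
          (∈-cartesianProduct⁺ (∈-listsOfLength (All.tabulate (λ {x} _ → ∈-allFin x)) ∣prefix∣≡h)
            (∈-listsOfLength (All.tabulate (λ {x} _ → ∈-letters x)) ∣values∣≡4))))
    where
    open ShiftedSelfMatch R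
    ∣prefix∣≡h : length (take ⌊ length p /2⌋ p) ≡ ⌊ length p /2⌋
    ∣prefix∣≡h = length-take-≤ p (⌊n/2⌋≤n (length p))
    ∣values∣≡4 : length (map (p !?_) (M ++ map (i +_) M)) ≡ 4
    ∣values∣≡4 = trans (length-map (p !?_) (M ++ map (i +_) M))
      (trans (length-++ M) (cong₂ _+_ M-length (trans (length-map (i +_) M) M-length)))
    ∈-letters : ∀ x → x ∈ letters
    ∈-letters nothing  = here refl
    ∈-letters (just x) = there (∈-map⁺ just (∈-allFin x))

  B1-count : ∀ n (S : List (Str σ)) → Unique S → All (λ p → length p ≡ n × InB1 p) S →
             length S ≤ n * (suc n * (n ^ 2 * (σ ^ ⌊ n /2⌋ * suc σ ^ 4)))
  B1-count n S S! S⊆B1 =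
    subst (length S ≤_) (proj₂ (sizedCodes n))
      (length-≤-by-injection code code-injective S! S⊆B1 code-∈)
    where
    code : ∀ {p} → length p ≡ n × InB1 p → Code
    code {p} (_ , b1) = encode p (witness b1)
    code-injective : ∀ {p p′} (P : length p ≡ n × InB1 p) (P′ : length p′ ≡ n × InB1 p′) →
                     code P ≡ code P′ → p ≡ p′
    code-injective (∣p∣≡n , b1) (∣p′∣≡n , b1′) =
      encode-injective (witness b1) (witness b1′) (trans ∣p∣≡n (sym ∣p′∣≡n))
    code-∈ : ∀ {p} → p ∈ S → (P : length p ≡ n × InB1 p) → code P ∈ proj₁ (sizedCodes n)
    code-∈ _ (∣p∣≡n , b1) =
      subst (λ m → _ ∈ proj₁ (sizedCodes m)) ∣p∣≡n (encode-∈-sizedCodes (witness b1))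

square-bound : ∀ {L n s c} .{{_ : NonZero s}} → 1 ≤ n →
               L ≤ n * (suc n * (n ^ 2 * (s ^ ⌊ n /2⌋ * c))) → L ^ 2 ≤ 4 * c ^ 2 * n ^ 8 * s ^ n
square-bound {L} {n} {s} {c} 1≤n L≤ = begin
  L ^ 2                        ≤⟨ ^-monoˡ-≤ 2 L≤X ⟩
  X ^ 2                        ≡⟨ expand n a c ⟩
  4 * c ^ 2 * n ^ 8 * (a * a)  ≤⟨ *-monoʳ-≤ (4 * c ^ 2 * n ^ 8) a*a≤s^n ⟩
  4 * c ^ 2 * n ^ 8 * s ^ n    ∎
  where
  open ≤-Reasoning
  a = s ^ ⌊ n /2⌋
  X = n * ((n + n) * (n ^ 2 * (a * c)))
  L≤X : L ≤ X
  L≤X = ≤-trans L≤ (*-monoʳ-≤ n (*-monoˡ-≤ (n ^ 2 * (a * c)) (+-monoˡ-≤ n 1≤n)))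
  -- The ring solver does not reflect _^_, so the powers are written out.
  expand : ∀ x y z → let X = x * ((x + x) * (x * (x * 1) * (y * z))) in
           X * (X * 1) ≡
           4 * (z * (z * 1)) * (x * (x * (x * (x * (x * (x * (x * (x * 1)))))))) * (y * y)
  expand = solve-∀
  a*a≤s^n : a * a ≤ s ^ n
  a*a≤s^n = begin
    a * a                        ≡⟨ ^-distribˡ-+-* s ⌊ n /2⌋ ⌊ n /2⌋ ⟨
    s ^ (⌊ n /2⌋ + ⌊ n /2⌋)      ≤⟨ ^-monoʳ-≤ s (⌊n/2⌋+⌊n/2⌋≤n n) ⟩
    s ^ n                        ∎

lemma4 : (σ : ℕ) → ∃[ C ] ((n : ℕ) → 1 ≤ n → (S : List (Str σ)) → Unique S →
           All (λ p → length p ≡ n × InB1 p) S →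
           length S ^ 2 ≤ C * n ^ 8 * σ ^ n)
lemma4 σ = 4 * (suc σ ^ 4) ^ 2 , bound σ
  where
  bound : ∀ s n → 1 ≤ n → (S : List (Str s)) → Unique S → All (λ p → length p ≡ n × InB1 p) S →
          length S ^ 2 ≤ 4 * (suc s ^ 4) ^ 2 * n ^ 8 * s ^ n
  bound zero    zero    ()  _                _  _
  bound zero    (suc n) _   []               _  _                  = z≤n
  bound zero    (suc n) _   ([] ∷ _)         _  ((() , _) ∷ _)
  bound zero    (suc n) _   ((() ∷ _) ∷ _)   _  _
  bound (suc s) n       1≤n S                S! S⊆B1 = square-bound 1≤n (B1-count n S S! S⊆B1)
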